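{- Let $Q$ and $n$ be positive integers. Then $S_{Qn}(Qn)\equiv n \pmod{Qn}$ if and only if both of the following conditions hold: (i) for every prime $p$ dividing $Q$, we have $p-1\mid Qn$ and $\frac{Q}{p}+1\equiv 0\pmod{p}$; (ii) for every prime $p$ with $p\mid n$ and $p\nmid Q$, we have $p-1\nmid Qn$.
   Context: For positive integers $m,k$, $S_m(k):=1^m+2^m+\cdots+k^m$. -}

module Defs where

open import Data.Nat using (ℕ; zero; suc; _+_; _^_)

S : ℕ → ℕ → ℕ
S m zero    = 0
S m (suc k) = S m k + suc k ^ m

-- Write N = Q n. Whether N divides S_N(N) − n can be decided one prime at a time: for each
-- prime p ∣ N write N = p^(f+1) M with p ∤ M. Cutting 1, …, N into M blocks of length p^(f+1)
-- gives S_N(N) ≡ M S_N(p^(f+1)), and because p ∣ N, cutting 1, …, p^(f+1) into p blocks of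
-- length p^f only costs a factor p, so S_N(p^(f+1)) ≡ p^f S_N(p), all modulo p^(f+1). By
-- Fermat's little theorem and the vanishing of 0^k + ⋯ + (p − 1)^k modulo p for k < p − 1,
-- S_N(p) ≡ −1 or 0 (mod p) according as p − 1 ∣ N or not. So S_N(N) ≡ −p^f M or 0, and the
-- congruence with n becomes p^(f+1) ∣ p^f M + n or p^(f+1) ∣ n respectively. If p ∣ Q then
-- p^(f+1) ∤ n and p^f M + n = n (Q/p + 1); if p ∤ Q then p^(f+1) ∣ n. This is exactly what
-- conditions (i) and (ii) say at p.
module Submission where

open import Defs

module PowerSumCongruence where

  open import Algebra.Bundles using (AbelianGroup)
  open import Data.Empty using (⊥-elim)
  open import Data.Integer using (ℤ; +_; -_; _+_; _*_; _-_; _^_; 0ℤ; 1ℤ)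
  import Data.Integer as ℤ
  open import Data.Integer.Divisibility.Signed
  open import Data.Integer.Properties
  open import Data.Integer.Tactic.RingSolver using (solve-∀)
  open import Data.List.Base using ([]; _∷_)
  open import Data.List.Relation.Unary.All using (_∷_)
  open import Data.Nat as ℕ using (ℕ; zero; suc; NonZero)
  open import Data.Nat.Combinatorics
    using (_C_; nCn≡1; nC1≡n; nCk≡nC[n∸k]; k>n⇒nCk≡0; nCk+nC[k+1]≡[n+1]C[k+1])
  import Data.Nat.Divisibility as ℕ
  open import Data.Nat.DivMod
    using (_%_; _/_; m≡m%n+[m/n]*n; m%n<n; /-congˡ; m*n/n≡m; [m+kn]%n≡m%n)
  open import Data.Nat.Induction using (<-rec)
  open import Data.Nat.ListAction using (product)
  open import Data.Nat.Primality using (Prime; euclidsLemma; prime⇒nonZero; prime⇒nonTrivial)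
  open import Data.Nat.Primality.Factorisation using (factorise)
  import Data.Nat.Properties as ℕ
  import Data.Nat.Tactic.RingSolver as ℕ-Solver
  open import Data.Product using (∃; ∃₂; _×_; _,_; proj₁; proj₂)
  open import Data.Sum using (inj₁; inj₂)
  open import Function.Bundles using (_⇔_; mk⇔; Equivalence)
  open import Function.Construct.Composition using (_⇔-∘_)
  open import Relation.Binary.Bundles using (Setoid)
  open import Relation.Binary.PropositionalEquality
  open import Relation.Nullary using (¬_; yes; no)

  open import Algebra.Properties.Group (AbelianGroup.group +-0-abelianGroup) using (∙-cancelʳ)

  -- A record rather than a synonym for d ∣ a - b, so that a and b can be inferred.
  infix 4 _≈_mod_
  record _≈_mod_ (a b d : ℤ) : Set where
    constructor mod-intro
    field mod-elim : d ∣ a - b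
  open _≈_mod_ public

  ∣-resp-≡ : ∀ {d x y} → x ≡ y → d ∣ x → d ∣ y
  ∣-resp-≡ refl d∣x = d∣x

  mod-reflexive : ∀ {d a b} → a ≡ b → a ≈ b mod d
  mod-reflexive {a = a} refl = mod-intro (∣-resp-≡ (sym (+-inverseʳ a)) (divides 0ℤ refl))

  mod-refl : ∀ {d} a → a ≈ a mod d
  mod-refl a = mod-reflexive refl

  mod-sym : ∀ {d a b} → a ≈ b mod d → b ≈ a mod d
  mod-sym {a = a} {b} (mod-intro d∣a-b) = mod-intro (∣-resp-≡ (eq a b) (∣m⇒∣-m d∣a-b))
    where
    eq : ∀ a b → - (a - b) ≡ b - a
    eq = solve-∀

  mod-trans : ∀ {d a b c} → a ≈ b mod d → b ≈ c mod d → a ≈ c mod d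
  mod-trans {a = a} {b} {c} (mod-intro d∣a-b) (mod-intro d∣b-c) =
    mod-intro (∣-resp-≡ (eq a b c) (∣m∣n⇒∣m+n d∣a-b d∣b-c))
    where
    eq : ∀ a b c → (a - b) + (b - c) ≡ a - c
    eq = solve-∀

  mod-+ : ∀ {d a b c e} → a ≈ b mod d → c ≈ e mod d → a + c ≈ b + e mod d
  mod-+ {a = a} {b} {c} {e} (mod-intro d∣a-b) (mod-intro d∣c-e) =
    mod-intro (∣-resp-≡ (eq a b c e) (∣m∣n⇒∣m+n d∣a-b d∣c-e))
    where
    eq : ∀ a b c e → (a - b) + (c - e) ≡ (a + c) - (b + e)
    eq = solve-∀

  mod-* : ∀ {d a b c e} → a ≈ b mod d → c ≈ e mod d → a * c ≈ b * e mod d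
  mod-* {a = a} {b} {c} {e} (mod-intro d∣a-b) (mod-intro d∣c-e) =
    mod-intro (∣-resp-≡ (eq a b c e) (∣m∣n⇒∣m+n (∣n⇒∣m*n a d∣c-e) (∣m⇒∣m*n e d∣a-b)))
    where
    eq : ∀ a b c e → a * (c - e) + (a - b) * e ≡ a * c - b * e
    eq = solve-∀

  mod-*ˡ : ∀ {d a b} c → a ≈ b mod d → c * a ≈ c * b mod d
  mod-*ˡ c = mod-* (mod-refl c)

  mod-^ : ∀ {d a b} m → a ≈ b mod d → a ^ m ≈ b ^ m mod d
  mod-^ zero    a≈b = mod-refl 1ℤ
  mod-^ (suc m) a≈b = mod-* a≈b (mod-^ m a≈b)

  mod-∣ : ∀ {d e a b} → e ∣ d → a ≈ b mod d → a ≈ b mod e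
  mod-∣ e∣d (mod-intro d∣a-b) = mod-intro (∣-trans e∣d d∣a-b)

  mod-scale : ∀ {d a b} c → a ≈ b mod d → c * a ≈ c * b mod c * d
  mod-scale {d} {a} {b} c (mod-intro d∣a-b) = mod-intro (∣-resp-≡ (eq c a b) (*-monoʳ-∣ c d∣a-b))
    where
    eq : ∀ c a b → c * (a - b) ≡ c * a - c * b
    eq = solve-∀

  mod-∣⇔∣ : ∀ {d a b} → a ≈ b mod d → (d ∣ a ⇔ d ∣ b)
  mod-∣⇔∣ {a = a} {b} (mod-intro d∣a-b) =
    mk⇔ (λ d∣a → ∣-resp-≡ (eq₁ a b) (∣m∣n⇒∣m-n d∣a d∣a-b))
        (λ d∣b → ∣-resp-≡ (eq₂ a b) (∣m∣n⇒∣m+n d∣a-b d∣b))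
    where
    eq₁ : ∀ a b → a - (a - b) ≡ b
    eq₁ = solve-∀
    eq₂ : ∀ a b → (a - b) + b ≡ a
    eq₂ = solve-∀

  ∣⇒≈0 : ∀ {d a} → d ∣ a → a ≈ 0ℤ mod d
  ∣⇒≈0 {a = a} d∣a = mod-intro (∣-resp-≡ (sym (+-identityʳ a)) d∣a)

  mod-setoid : ℤ → Setoid _ _
  mod-setoid d = record
    { Carrier       = ℤ
    ; _≈_           = λ a b → a ≈ b mod d
    ; isEquivalence = record { refl = mod-refl _ ; sym = mod-sym ; trans = mod-trans }
    }

  module mod-Reasoning (d : ℤ) where
    open import Relation.Binary.Reasoning.Setoid (mod-setoid d) public

  +∣-+⇔∣ : ∀ {K Y} → + K ∣ - + Y ⇔ K ℕ.∣ Y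
  +∣-+⇔∣ {K} {Y} = mk⇔ (λ K∣-Y → subst (K ℕ.∣_) (∣-i∣≡∣i∣ (+ Y)) (∣⇒∣ᵤ K∣-Y))
                       (λ K∣Y → ∣ᵤ⇒∣ (subst (K ℕ.∣_) (sym (∣-i∣≡∣i∣ (+ Y))) K∣Y))

  %≡%⇒∣- : ∀ x y N .{{_ : NonZero N}} → x % N ≡ y % N → + N ∣ + x - + y
  %≡%⇒∣- x y N x%N≡y%N = divides (+ (x / N) - + (y / N)) (begin
    + x - + y
      ≡⟨ cong₂ _-_ (pos-div-mod x) (pos-div-mod y) ⟩
    (+ (x % N) + + (x / N) * + N) - (+ (y % N) + + (y / N) * + N)
      ≡⟨ cong (λ r → (+ (x % N) + + (x / N) * + N) - (+ r + + (y / N) * + N)) (sym x%N≡y%N) ⟩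
    (+ (x % N) + + (x / N) * + N) - (+ (x % N) + + (y / N) * + N)
      ≡⟨ eq (+ (x % N)) (+ (x / N)) (+ (y / N)) (+ N) ⟩
    (+ (x / N) - + (y / N)) * + N
      ∎)
    where
    open ≡-Reasoning
    pos-div-mod : ∀ z → + z ≡ + (z % N) + + (z / N) * + N
    pos-div-mod z =
      trans (cong +_ (m≡m%n+[m/n]*n z N)) (trans (pos-+ (z % N) _) (cong (_+_ (+ (z % N))) (pos-* (z / N) N)))
    eq : ∀ r a b n → (r + a * n) - (r + b * n) ≡ (a - b) * n
    eq = solve-∀

  ∣∸⇒%≡% : ∀ x y N .{{_ : NonZero N}} → y ℕ.≤ x → N ℕ.∣ x ℕ.∸ y → x % N ≡ y % N
  ∣∸⇒%≡% x y N y≤x (ℕ.divides k x∸y≡k*N) =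
    trans (cong (_% N) (trans (sym (ℕ.m+[n∸m]≡n y≤x)) (cong (y ℕ.+_) x∸y≡k*N))) ([m+kn]%n≡m%n y k N)

  ∣-⇒%≡% : ∀ x y N .{{_ : NonZero N}} → + N ∣ + x - + y → x % N ≡ y % N
  ∣-⇒%≡% x y N N∣x-y with ℕ.≤-total y x
  ... | inj₁ y≤x =
    ∣∸⇒%≡% x y N y≤x (∣⇒∣ᵤ (∣-resp-≡ (trans (m-n≡m⊖n x y) (⊖-≥ y≤x)) N∣x-y))
  ... | inj₂ x≤y =
    sym (∣∸⇒%≡% y x N x≤y (Equivalence.to +∣-+⇔∣ (∣-resp-≡ (trans (m-n≡m⊖n x y) (⊖-≤ x≤y)) N∣x-y)))

  %≡%⇔∣- : ∀ x y N .{{_ : NonZero N}} → x % N ≡ y % N ⇔ + N ∣ + x - + y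
  %≡%⇔∣- x y N = mk⇔ (%≡%⇒∣- x y N) (∣-⇒%≡% x y N)

  ∑< : ℕ → (ℕ → ℤ) → ℤ
  ∑< zero    f = 0ℤ
  ∑< (suc n) f = ∑< n f + f n

  syntax ∑< n (λ i → e) = ∑[ i < n ] e

  ∑-cong : ∀ n {f g} → (∀ i → i ℕ.< n → f i ≡ g i) → ∑< n f ≡ ∑< n g
  ∑-cong zero    f≡g = refl
  ∑-cong (suc n) f≡g =
    cong₂ _+_ (∑-cong n (λ i i<n → f≡g i (ℕ.m<n⇒m<1+n i<n))) (f≡g n ℕ.≤-refl)

  ∑-mod : ∀ {d} n {f g} → (∀ i → i ℕ.< n → f i ≈ g i mod d) → ∑< n f ≈ ∑< n g mod d
  ∑-mod zero    f≈g = mod-refl 0ℤ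
  ∑-mod (suc n) f≈g =
    mod-+ (∑-mod n (λ i i<n → f≈g i (ℕ.m<n⇒m<1+n i<n))) (f≈g n ℕ.≤-refl)

  ∑-∣ : ∀ {d} n {f} → (∀ i → i ℕ.< n → d ∣ f i) → d ∣ ∑< n f
  ∑-∣ zero    d∣f = divides 0ℤ refl
  ∑-∣ (suc n) d∣f =
    ∣m∣n⇒∣m+n (∑-∣ n (λ i i<n → d∣f i (ℕ.m<n⇒m<1+n i<n))) (d∣f n ℕ.≤-refl)

  ∑-+ : ∀ n f g → ∑[ i < n ] (f i + g i) ≡ ∑< n f + ∑< n g
  ∑-+ zero    f g = refl
  ∑-+ (suc n) f g =
    trans (cong (_+ (f n + g n)) (∑-+ n f g)) (eq (∑< n f) (∑< n g) (f n) (g n))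
    where
    eq : ∀ a b c d → (a + b) + (c + d) ≡ (a + c) + (b + d)
    eq = solve-∀

  ∑-*ˡ : ∀ n c f → ∑[ i < n ] (c * f i) ≡ c * ∑< n f
  ∑-*ˡ zero    c f = sym (*-zeroʳ c)
  ∑-*ˡ (suc n) c f =
    trans (cong (_+ c * f n) (∑-*ˡ n c f)) (sym (*-distribˡ-+ c (∑< n f) (f n)))

  ∑-const : ∀ n c → ∑[ i < n ] c ≡ + n * c
  ∑-const zero    c = sym (*-zeroˡ c)
  ∑-const (suc n) c =
    trans (cong (_+ c) (∑-const n c)) (trans (eq (+ n) c) (cong (_* c) (sym (pos-+ 1 n))))
    where
    eq : ∀ x c → x * c + c ≡ (1ℤ + x) * c
    eq = solve-∀

  ∑-head : ∀ n f → ∑< (suc n) f ≡ f 0 + ∑[ i < n ] f (suc i)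
  ∑-head zero    f = trans (+-identityˡ (f 0)) (sym (+-identityʳ (f 0)))
  ∑-head (suc n) f = trans (cong (_+ f (suc n)) (∑-head n f)) (+-assoc (f 0) _ _)

  ∑-split : ∀ m k f → ∑< (m ℕ.+ k) f ≡ ∑< m f + ∑[ r < k ] f (m ℕ.+ r)
  ∑-split m zero    f = trans (cong (λ l → ∑< l f) (ℕ.+-identityʳ m)) (sym (+-identityʳ _))
  ∑-split m (suc k) f = begin
    ∑< (m ℕ.+ suc k) f                               ≡⟨ cong (λ l → ∑< l f) (ℕ.+-suc m k) ⟩
    ∑< (m ℕ.+ k) f + f (m ℕ.+ k)                     ≡⟨ cong (_+ f (m ℕ.+ k)) (∑-split m k f) ⟩
    (∑< m f + ∑[ r < k ] f (m ℕ.+ r)) + f (m ℕ.+ k)  ≡⟨ +-assoc (∑< m f) _ _ ⟩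
    ∑< m f + ∑[ r < suc k ] f (m ℕ.+ r)              ∎
    where open ≡-Reasoning

  ∑-blocks : ∀ a K f → ∑< (a ℕ.* K) f ≡ ∑[ j < a ] ∑[ r < K ] f (j ℕ.* K ℕ.+ r)
  ∑-blocks zero    K f = refl
  ∑-blocks (suc a) K f = begin
    ∑< (K ℕ.+ a ℕ.* K) f                           ≡⟨ cong (λ l → ∑< l f) (ℕ.+-comm K (a ℕ.* K)) ⟩
    ∑< (a ℕ.* K ℕ.+ K) f                           ≡⟨ ∑-split (a ℕ.* K) K f ⟩
    ∑< (a ℕ.* K) f + ∑[ r < K ] f (a ℕ.* K ℕ.+ r)  ≡⟨ cong (_+ ∑[ r < K ] f (a ℕ.* K ℕ.+ r))
                                                          (∑-blocks a K f) ⟩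
    ∑[ j < suc a ] ∑[ r < K ] f (j ℕ.* K ℕ.+ r)    ∎
    where open ≡-Reasoning

  ∑-swap : ∀ a b (F : ℕ → ℕ → ℤ) → ∑[ j < a ] ∑[ r < b ] F j r ≡ ∑[ r < b ] ∑[ j < a ] F j r
  ∑-swap zero    b F = trans (sym (*-zeroʳ (+ b))) (sym (∑-const b 0ℤ))
  ∑-swap (suc a) b F =
    trans (cong (_+ ∑< b (F a)) (∑-swap a b F)) (sym (∑-+ b (λ r → ∑[ j < a ] F j r) (F a)))

  -- Binomial coefficients and Fermat's little theorem

  [k+1]*[n+1]C[k+1]≡[n+1]*nCk : ∀ n k → suc k ℕ.* (suc n C suc k) ≡ suc n ℕ.* (n C k)
  [k+1]*[n+1]C[k+1]≡[n+1]*nCk zero    zero    = refl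
  [k+1]*[n+1]C[k+1]≡[n+1]*nCk zero    (suc k) =
    trans (cong (suc (suc k) ℕ.*_) (k>n⇒nCk≡0 {1} {suc (suc k)} (ℕ.s≤s (ℕ.s≤s ℕ.z≤n))))
          (ℕ.*-zeroʳ (suc (suc k)))
  [k+1]*[n+1]C[k+1]≡[n+1]*nCk (suc n) zero    =
    trans (ℕ.+-identityʳ _) (trans (nC1≡n (suc (suc n))) (sym (ℕ.*-identityʳ _)))
  [k+1]*[n+1]C[k+1]≡[n+1]*nCk (suc n) (suc k) = begin
    suc (suc k) ℕ.* (suc (suc n) C suc (suc k))
      ≡⟨ cong (suc (suc k) ℕ.*_) (sym (nCk+nC[k+1]≡[n+1]C[k+1] (suc n) (suc k))) ⟩
    suc (suc k) ℕ.* (a ℕ.+ b)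
      ≡⟨ eq (suc k) a b ⟩
    a ℕ.+ suc k ℕ.* a ℕ.+ suc (suc k) ℕ.* b
      ≡⟨ cong₂ (λ u v → a ℕ.+ u ℕ.+ v) ([k+1]*[n+1]C[k+1]≡[n+1]*nCk n k)
                                       ([k+1]*[n+1]C[k+1]≡[n+1]*nCk n (suc k)) ⟩
    a ℕ.+ suc n ℕ.* (n C k) ℕ.+ suc n ℕ.* (n C suc k)
      ≡⟨ eq′ (suc n) a (n C k) (n C suc k) ⟩
    a ℕ.+ suc n ℕ.* (n C k ℕ.+ n C suc k)
      ≡⟨ cong (λ u → a ℕ.+ suc n ℕ.* u) (nCk+nC[k+1]≡[n+1]C[k+1] n k) ⟩
    suc (suc n) ℕ.* a
      ∎
    where
    open ≡-Reasoning
    a = suc n C suc k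
    b = suc n C suc (suc k)
    eq : ∀ k a b → (1 ℕ.+ k) ℕ.* (a ℕ.+ b) ≡ a ℕ.+ k ℕ.* a ℕ.+ (1 ℕ.+ k) ℕ.* b
    eq = ℕ-Solver.solve-∀
    eq′ : ∀ m a c d → a ℕ.+ m ℕ.* c ℕ.+ m ℕ.* d ≡ a ℕ.+ m ℕ.* (c ℕ.+ d)
    eq′ = ℕ-Solver.solve-∀

  binomial-theorem : ∀ n x → (1ℤ + x) ^ n ≡ ∑[ k < suc n ] (+ (n C k) * x ^ k)
  binomial-theorem zero    x = refl
  binomial-theorem (suc n) x = begin
    (1ℤ + x) * (1ℤ + x) ^ n  ≡⟨ cong ((1ℤ + x) *_) (binomial-theorem n x) ⟩
    (1ℤ + x) * T             ≡⟨ eq x T ⟩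
    x * T + T                ≡⟨ cong₂ _+_ xT≡A T≡1+B ⟩
    A + (1ℤ + B)             ≡⟨ eq′ A B ⟩
    1ℤ + (A + B)             ≡⟨ cong (_+_ 1ℤ) (sym (∑-+ (suc n) _ _)) ⟩
    1ℤ + ∑[ k < suc n ] (+ (n C k) * x ^ suc k + + (n C suc k) * x ^ suc k)
                             ≡⟨ cong (_+_ 1ℤ) (∑-cong (suc n) λ k _ → pascal k) ⟩
    1ℤ + ∑[ k < suc n ] (+ (suc n C suc k) * x ^ suc k)
                             ≡⟨ sym (∑-head (suc n) _) ⟩
    ∑[ k < suc (suc n) ] (+ (suc n C k) * x ^ k)
                             ∎
    where
    open ≡-Reasoning
    T  = ∑[ k < suc n ] (+ (n C k) * x ^ k)
    A  = ∑[ k < suc n ] (+ (n C k) * x ^ suc k)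
    B′ = ∑[ k < n ] (+ (n C suc k) * x ^ suc k)
    B  = ∑[ k < suc n ] (+ (n C suc k) * x ^ suc k)
    eq : ∀ x T → (1ℤ + x) * T ≡ x * T + T
    eq = solve-∀
    eq′ : ∀ A B → A + (1ℤ + B) ≡ 1ℤ + (A + B)
    eq′ = solve-∀
    xT≡A : x * T ≡ A
    xT≡A = trans (sym (∑-*ˡ (suc n) x _)) (∑-cong (suc n) λ k _ → eq″ x (+ (n C k)) (x ^ k))
      where
      eq″ : ∀ x c y → x * (c * y) ≡ c * (x * y)
      eq″ = solve-∀
    T≡1+B : T ≡ 1ℤ + B
    T≡1+B = begin
      T                  ≡⟨ ∑-head n _ ⟩
      1ℤ + B′            ≡⟨ cong (_+_ 1ℤ) (sym (+-identityʳ B′)) ⟩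
      1ℤ + (B′ + 0ℤ)     ≡⟨ cong (λ c → 1ℤ + (B′ + + c * x ^ suc n)) (sym (k>n⇒nCk≡0 (ℕ.n<1+n n))) ⟩
      1ℤ + B             ∎
    pascal : ∀ k → + (n C k) * x ^ suc k + + (n C suc k) * x ^ suc k ≡ + (suc n C suc k) * x ^ suc k
    pascal k = trans (sym (*-distribʳ-+ (x ^ suc k) (+ (n C k)) (+ (n C suc k))))
                     (cong (_* x ^ suc k) (trans (sym (pos-+ (n C k) (n C suc k)))
                                                 (cong +_ (nCk+nC[k+1]≡[n+1]C[k+1] n k))))

  <⇒∤ : ∀ {p k} .{{_ : NonZero k}} → k ℕ.< p → ¬ p ℕ.∣ k
  <⇒∤ k<p p∣k = ℕ.<⇒≱ k<p (ℕ.∣⇒≤ p∣k)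

  euclidsLemma′ : ∀ {p a} b → Prime p → ¬ p ℕ.∣ a → p ℕ.∣ a ℕ.* b → p ℕ.∣ b
  euclidsLemma′ {a = a} b pr p∤a p∣ab with euclidsLemma a b pr p∣ab
  ... | inj₁ p∣a = ⊥-elim (p∤a p∣a)
  ... | inj₂ p∣b = p∣b

  euclidsLemmaℤ : ∀ {p a} y → Prime p → ¬ p ℕ.∣ a → + p ∣ + a * y → + p ∣ y
  euclidsLemmaℤ {p} {a} y pr p∤a p∣ay =
    ∣ᵤ⇒∣ (euclidsLemma′ ℤ.∣ y ∣ pr p∤a (subst (p ℕ.∣_) (abs-* (+ a) y) (∣⇒∣ᵤ p∣ay)))

  p∣pCk : ∀ {p k} → Prime p → 0 ℕ.< k → k ℕ.< p → p ℕ.∣ p C k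
  p∣pCk {suc n} {suc i} pr _ k<p = euclidsLemma′ (suc n C suc i) pr (<⇒∤ k<p)
    (ℕ.divides (n C i) (trans ([k+1]*[n+1]C[k+1]≡[n+1]*nCk n i) (ℕ.*-comm (suc n) (n C i))))

  freshmans-dream : ∀ {p} → Prime p → ∀ x → (1ℤ + x) ^ p ≈ 1ℤ + x ^ p mod + p
  freshmans-dream {suc n} pr x = begin
    (1ℤ + x) ^ suc n
      ≡⟨ binomial-theorem (suc n) x ⟩
    ∑[ k < suc (suc n) ] (+ (suc n C k) * x ^ k)
      ≡⟨ ∑-head (suc n) _ ⟩
    1ℤ + (∑[ k < n ] (+ (suc n C suc k) * x ^ suc k) + + (suc n C suc n) * x ^ suc n)
      ≈⟨ mod-+ (mod-refl 1ℤ) (mod-+ (∣⇒≈0 inner-terms) (mod-refl _)) ⟩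
    1ℤ + (0ℤ + + (suc n C suc n) * x ^ suc n)
      ≡⟨ cong (λ c → 1ℤ + (0ℤ + + c * x ^ suc n)) (nCn≡1 (suc n)) ⟩
    1ℤ + (0ℤ + 1ℤ * x ^ suc n)
      ≡⟨ cong (_+_ 1ℤ) (trans (+-identityˡ (1ℤ * x ^ suc n)) (*-identityˡ (x ^ suc n))) ⟩
    1ℤ + x ^ suc n
      ∎
    where
    open mod-Reasoning (+ suc n)
    inner-terms : + suc n ∣ ∑[ k < n ] (+ (suc n C suc k) * x ^ suc k)
    inner-terms = ∑-∣ n λ k k<n →
      ∣m⇒∣m*n {m = + (suc n C suc k)} (x ^ suc k) (∣ᵤ⇒∣ (p∣pCk pr (ℕ.s≤s ℕ.z≤n) (ℕ.s≤s k<n)))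

  fermat : ∀ {p} → Prime p → ∀ a → (+ a) ^ p ≈ + a mod + p
  fermat {suc n} pr zero    = mod-refl 0ℤ
  fermat {suc n} pr (suc a) = mod-trans (freshmans-dream pr (+ a)) (mod-+ (mod-refl 1ℤ) (fermat pr a))

  fermat-unit : ∀ {p a} → Prime p → ¬ p ℕ.∣ a → (+ a) ^ (p ℕ.∸ 1) ≈ 1ℤ mod + p
  fermat-unit {suc n} {a} pr p∤a =
    mod-intro (euclidsLemmaℤ ((+ a) ^ n - 1ℤ) pr p∤a (∣-resp-≡ (eq (+ a) _) (mod-elim (fermat pr a))))
    where
    eq : ∀ x y → x * y - x ≡ x * (y - 1ℤ)
    eq = solve-∀

  -- Power sums modulo a prime

  powerSum : ℕ → ℕ → ℤ
  powerSum m n = ∑[ i < n ] ((+ i) ^ m)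

  ∑-shifted-powers : ∀ M n → ∑[ i < n ] ((+ suc i) ^ M) ≡ ∑[ k < suc M ] (+ (M C k) * powerSum k n)
  ∑-shifted-powers M n = begin
    ∑[ i < n ] ((1ℤ + + i) ^ M)                         ≡⟨ ∑-cong n (λ i _ → binomial-theorem M (+ i)) ⟩
    ∑[ i < n ] ∑[ k < suc M ] (+ (M C k) * (+ i) ^ k)  ≡⟨ ∑-swap n (suc M) _ ⟩
    ∑[ k < suc M ] ∑[ i < n ] (+ (M C k) * (+ i) ^ k)  ≡⟨ ∑-cong (suc M) (λ k _ → ∑-*ˡ n (+ (M C k)) _) ⟩
    ∑[ k < suc M ] (+ (M C k) * powerSum k n)          ∎
    where open ≡-Reasoning

  -- Telescoping: the sum over i < n of (i + 1)^(m+1) − i^(m+1) is n^(m+1).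
  powerSum-recurrence : ∀ m n → ∑[ k < suc m ] (+ (suc m C k) * powerSum k n) ≡ (+ n) ^ suc m
  powerSum-recurrence m n = ∙-cancelʳ (powerSum M n) _ _ (begin
    ∑[ k < suc m ] (+ (M C k) * powerSum k n) + powerSum M n
      ≡⟨ cong (λ z → ∑[ k < suc m ] (+ (M C k) * powerSum k n) + z) (sym top-term) ⟩
    ∑[ k < suc M ] (+ (M C k) * powerSum k n)
      ≡⟨ sym (∑-shifted-powers M n) ⟩
    ∑[ i < n ] ((+ suc i) ^ M)
      ≡⟨ sym (trans (∑-head n λ i → (+ i) ^ M) (+-identityˡ _)) ⟩
    powerSum M (suc n)
      ≡⟨ +-comm (powerSum M n) _ ⟩
    (+ n) ^ M + powerSum M n
      ∎)
    where
    open ≡-Reasoning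
    M = suc m
    top-term : + (M C M) * powerSum M n ≡ powerSum M n
    top-term = trans (cong (λ c → + c * powerSum M n) (nCn≡1 M)) (*-identityˡ _)

  [n+1]Cn≡n+1 : ∀ n → suc n C n ≡ suc n
  [n+1]Cn≡n+1 n = trans (nCk≡nC[n∸k] (ℕ.n≤1+n n)) (trans (cong (suc n C_) (ℕ.m+n∸n≡m 1 n)) (nC1≡n (suc n)))

  p∣powerSum[m<p-1] : ∀ {p} → Prime p → ∀ m → suc m ℕ.< p → + p ∣ powerSum m p
  p∣powerSum[m<p-1] {p} pr = <-rec (λ m → suc m ℕ.< p → + p ∣ powerSum m p) step
    where
    step : ∀ m → (∀ {k} → k ℕ.< m → suc k ℕ.< p → + p ∣ powerSum k p) → suc m ℕ.< p → + p ∣ powerSum m p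
    step m ih m<p-1 = euclidsLemmaℤ (powerSum m p) pr (<⇒∤ m<p-1) [m+1]*powerSum
      where
      lower-terms : + p ∣ ∑[ k < m ] (+ (suc m C k) * powerSum k p)
      lower-terms = ∑-∣ m λ k k<m → ∣n⇒∣m*n (+ (suc m C k)) (ih k<m (ℕ.<-trans (ℕ.s≤s k<m) m<p-1))
      top-term : + p ∣ + (suc m C m) * powerSum m p
      top-term = ∣m+n∣m⇒∣n (∣-resp-≡ (sym (powerSum-recurrence m p)) (∣m⇒∣m*n _ ∣-refl)) lower-terms
      [m+1]*powerSum : + p ∣ + suc m * powerSum m p
      [m+1]*powerSum = ∣-resp-≡ (cong (λ c → + c * powerSum m p) ([n+1]Cn≡n+1 m)) top-term

  0^n≡0 : ∀ n .{{_ : NonZero n}} → 0ℤ ^ n ≡ 0ℤ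
  0^n≡0 (suc n) = refl

  a^[r+t[p-1]]≈a^r : ∀ {p a} → Prime p → ¬ p ℕ.∣ a → ∀ r t →
                     (+ a) ^ (r ℕ.+ t ℕ.* (p ℕ.∸ 1)) ≈ (+ a) ^ r mod + p
  a^[r+t[p-1]]≈a^r {p} {a} pr p∤a r t = begin
    x ^ (r ℕ.+ t ℕ.* (p ℕ.∸ 1))    ≡⟨ ^-distribˡ-+-* x r (t ℕ.* (p ℕ.∸ 1)) ⟩
    x ^ r * x ^ (t ℕ.* (p ℕ.∸ 1))  ≡⟨ cong (λ e → x ^ r * x ^ e) (ℕ.*-comm t (p ℕ.∸ 1)) ⟩
    x ^ r * x ^ ((p ℕ.∸ 1) ℕ.* t)  ≡⟨ cong (x ^ r *_) (sym (^-*-assoc x (p ℕ.∸ 1) t)) ⟩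
    x ^ r * (x ^ (p ℕ.∸ 1)) ^ t    ≈⟨ mod-*ˡ (x ^ r) (mod-^ t (fermat-unit pr p∤a)) ⟩
    x ^ r * 1ℤ ^ t                 ≡⟨ cong (x ^ r *_) (^-zeroˡ t) ⟩
    x ^ r * 1ℤ                     ≡⟨ *-identityʳ (x ^ r) ⟩
    x ^ r                          ∎
    where
    open mod-Reasoning (+ p)
    x = + a

  powerSum≈-1 : ∀ {p m} → Prime p → (p ℕ.∸ 1) ℕ.∣ m → .{{NonZero m}} → powerSum m p ≈ - 1ℤ mod + p
  powerSum≈-1 {suc n} {m} pr (ℕ.divides t m≡t*n) = begin
    powerSum m (suc n)                   ≡⟨ ∑-head n (λ i → (+ i) ^ m) ⟩
    0ℤ ^ m + ∑[ i < n ] ((+ suc i) ^ m)  ≈⟨ mod-+ (mod-reflexive (0^n≡0 m)) (∑-mod n unit-power) ⟩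
    0ℤ + ∑[ i < n ] 1ℤ                   ≡⟨ trans (+-identityˡ _) (trans (∑-const n 1ℤ) (*-identityʳ (+ n))) ⟩
    + n                                  ≈⟨ mod-intro (∣-resp-≡ (cong +_ (ℕ.+-comm 1 n)) ∣-refl) ⟩
    - 1ℤ                                 ∎
    where
    open mod-Reasoning (+ suc n)
    unit-power : ∀ i → i ℕ.< n → (+ suc i) ^ m ≈ 1ℤ mod + suc n
    unit-power i i<n = begin
      (+ suc i) ^ m                ≡⟨ cong ((+ suc i) ^_) m≡t*n ⟩
      (+ suc i) ^ (0 ℕ.+ t ℕ.* n)  ≈⟨ a^[r+t[p-1]]≈a^r pr (<⇒∤ (ℕ.s≤s i<n)) 0 t ⟩
      1ℤ                           ∎

  p∣powerSum[p-1∤m] : ∀ {p m} → Prime p → ¬ (p ℕ.∸ 1) ℕ.∣ m → + p ∣ powerSum m p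
  p∣powerSum[p-1∤m] {suc (suc q)} {m} pr p-1∤m =
    Equivalence.from (mod-∣⇔∣ (∑-mod (suc (suc q)) term)) (p∣powerSum[m<p-1] pr r (ℕ.s≤s (m%n<n m (suc q))))
    where
    r = m % suc q
    t = m / suc q
    m≡r+t*n : m ≡ r ℕ.+ t ℕ.* suc q
    m≡r+t*n = m≡m%n+[m/n]*n m (suc q)
    instance
      r≢0 : NonZero r
      r≢0 = ℕ.≢-nonZero λ r≡0 → p-1∤m (ℕ.m%n≡0⇒n∣m m (suc q) r≡0)
    term : ∀ i → i ℕ.< suc (suc q) → (+ i) ^ m ≈ (+ i) ^ r mod + suc (suc q)
    term zero    _   = mod-reflexive (begin
      0ℤ ^ m                       ≡⟨ cong (0ℤ ^_) m≡r+t*n ⟩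
      0ℤ ^ (r ℕ.+ t ℕ.* suc q)     ≡⟨ ^-distribˡ-+-* 0ℤ r (t ℕ.* suc q) ⟩
      0ℤ ^ r * 0ℤ ^ (t ℕ.* suc q)  ≡⟨ cong (_* 0ℤ ^ (t ℕ.* suc q)) (0^n≡0 r) ⟩
      0ℤ                           ≡⟨ sym (0^n≡0 r) ⟩
      0ℤ ^ r                       ∎)
      where open ≡-Reasoning
    term (suc i) i<p =
      mod-trans (mod-reflexive (cong ((+ suc i) ^_) m≡r+t*n)) (a^[r+t[p-1]]≈a^r pr (<⇒∤ i<p) r t)

  -- Power sums modulo prime powers

  powerSum-blocks : ∀ {d} m a K → (∀ j r → (+ (j ℕ.* K ℕ.+ r)) ^ m ≈ (+ r) ^ m mod d) →
                    powerSum m (a ℕ.* K) ≈ + a * powerSum m K mod d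
  powerSum-blocks {d} m a K shift = begin
    powerSum m (a ℕ.* K)                             ≡⟨ ∑-blocks a K (λ i → (+ i) ^ m) ⟩
    ∑[ j < a ] ∑[ r < K ] ((+ (j ℕ.* K ℕ.+ r)) ^ m)  ≈⟨ ∑-mod a (λ j _ → ∑-mod K (λ r _ → shift j r)) ⟩
    ∑[ j < a ] powerSum m K                          ≡⟨ ∑-const a (powerSum m K) ⟩
    + a * powerSum m K                               ∎
    where open mod-Reasoning d

  powerSum-periodic : ∀ m a K → powerSum m (a ℕ.* K) ≈ + a * powerSum m K mod + K
  powerSum-periodic m a K = powerSum-blocks m a K λ j r → mod-^ m (mod-intro (divides (+ j) (begin
    + (j ℕ.* K ℕ.+ r) - + r  ≡⟨ cong (_- + r) (pos-+ (j ℕ.* K) r) ⟩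
    + (j ℕ.* K) + + r - + r  ≡⟨ eq (+ (j ℕ.* K)) (+ r) ⟩
    + (j ℕ.* K)              ≡⟨ pos-* j K ⟩
    + j * + K                ∎)))
    where
    open ≡-Reasoning
    eq : ∀ a b → a + b - b ≡ a
    eq = solve-∀

  [a+b]^[k+1]≈a^[k+1]+[k+1]ba^k : ∀ a b k → (a + b) ^ suc k ≈ a ^ suc k + + suc k * b * a ^ k mod b * b
  [a+b]^[k+1]≈a^[k+1]+[k+1]ba^k a b zero    = mod-reflexive (eq a b)
    where
    eq : ∀ a b → (a + b) * 1ℤ ≡ a * 1ℤ + 1ℤ * b * 1ℤ
    eq = solve-∀
  [a+b]^[k+1]≈a^[k+1]+[k+1]ba^k a b (suc k) = begin
    (a + b) * (a + b) ^ suc k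
      ≈⟨ mod-*ˡ (a + b) ([a+b]^[k+1]≈a^[k+1]+[k+1]ba^k a b k) ⟩
    (a + b) * (a ^ suc k + + suc k * b * a ^ k)
      ≡⟨ eq a b (+ suc k) (a ^ k) ⟩
    a ^ suc (suc k) + + suc (suc k) * b * a ^ suc k + + suc k * a ^ k * (b * b)
      ≈⟨ mod-+ (mod-refl (a ^ suc (suc k) + + suc (suc k) * b * a ^ suc k))
               (∣⇒≈0 (∣n⇒∣m*n (+ suc k * a ^ k) ∣-refl)) ⟩
    a ^ suc (suc k) + + suc (suc k) * b * a ^ suc k + 0ℤ
      ≡⟨ +-identityʳ _ ⟩
    a ^ suc (suc k) + + suc (suc k) * b * a ^ suc k
      ∎
    where
    open mod-Reasoning (b * b)
    eq : ∀ a b c y → (a + b) * (a * y + c * b * y) ≡ a * (a * y) + (1ℤ + c) * b * (a * y) + c * y * (b * b)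
    eq = solve-∀

  powerSum-lift : ∀ {p} m K → p ℕ.∣ m → p ℕ.∣ K → powerSum m (p ℕ.* K) ≈ + p * powerSum m K mod + (p ℕ.* K)
  powerSum-lift {p} zero    K p∣m p∣K = powerSum-blocks zero p K λ _ _ → mod-refl 1ℤ
  powerSum-lift {p} (suc k) K p∣m p∣K = powerSum-blocks (suc k) p K shift
    where
    shift : ∀ j r → (+ (j ℕ.* K ℕ.+ r)) ^ suc k ≈ (+ r) ^ suc k mod + (p ℕ.* K)
    shift j r = begin
      (+ (j ℕ.* K ℕ.+ r)) ^ suc k
        ≡⟨ cong (_^ suc k) (trans (pos-+ (j ℕ.* K) r) (+-comm (+ (j ℕ.* K)) (+ r))) ⟩
      (+ r + + (j ℕ.* K)) ^ suc k
        ≈⟨ mod-∣ pK∣jK*jK ([a+b]^[k+1]≈a^[k+1]+[k+1]ba^k (+ r) (+ (j ℕ.* K)) k) ⟩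
      (+ r) ^ suc k + + suc k * + (j ℕ.* K) * (+ r) ^ k
        ≈⟨ mod-+ (mod-refl ((+ r) ^ suc k)) (∣⇒≈0 pK∣[k+1]*jK*r^k) ⟩
      (+ r) ^ suc k + 0ℤ
        ≡⟨ +-identityʳ _ ⟩
      (+ r) ^ suc k
        ∎
      where
      open mod-Reasoning (+ (p ℕ.* K))
      pK∣jK*jK : + (p ℕ.* K) ∣ + (j ℕ.* K) * + (j ℕ.* K)
      pK∣jK*jK = ∣-resp-≡ (pos-* (j ℕ.* K) (j ℕ.* K)) (∣ᵤ⇒∣ (ℕ.*-pres-∣ (ℕ.∣n⇒∣m*n j p∣K) (ℕ.n∣m*n j)))
      pK∣[k+1]*jK*r^k : + (p ℕ.* K) ∣ + suc k * + (j ℕ.* K) * (+ r) ^ k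
      pK∣[k+1]*jK*r^k =
        ∣m⇒∣m*n ((+ r) ^ k) (∣-resp-≡ (pos-* (suc k) (j ℕ.* K)) (∣ᵤ⇒∣ (ℕ.*-pres-∣ p∣m (ℕ.n∣m*n j))))

  powerSum-prime-power : ∀ {p} m e → p ℕ.∣ m →
                         powerSum m (p ℕ.^ suc e) ≈ + (p ℕ.^ e) * powerSum m p mod + (p ℕ.^ suc e)
  powerSum-prime-power {p} m zero    p∣m =
    mod-reflexive (trans (cong (powerSum m) (ℕ.*-identityʳ p)) (sym (*-identityˡ _)))
  powerSum-prime-power {p} m (suc e) p∣m = begin
    powerSum m (p ℕ.* p ℕ.^ suc e)      ≈⟨ powerSum-lift m (p ℕ.^ suc e) p∣m (ℕ.m∣m*n (p ℕ.^ e)) ⟩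
    + p * powerSum m (p ℕ.^ suc e)      ≈⟨ mod-∣ (∣-reflexive (pos-* p (p ℕ.^ suc e)))
                                                 (mod-scale (+ p) (powerSum-prime-power m e p∣m)) ⟩
    + p * (+ (p ℕ.^ e) * powerSum m p)  ≡⟨ sym (*-assoc (+ p) _ _) ⟩
    + p * + (p ℕ.^ e) * powerSum m p    ≡⟨ cong (_* powerSum m p) (sym (pos-* p (p ℕ.^ e))) ⟩
    + (p ℕ.^ suc e) * powerSum m p      ∎
    where open mod-Reasoning (+ (p ℕ.^ suc (suc e)))

  pos-^ : ∀ a m → + (a ℕ.^ m) ≡ (+ a) ^ m
  pos-^ a zero    = refl
  pos-^ a (suc m) = trans (pos-* a (a ℕ.^ m)) (cong (+ a *_) (pos-^ a m))

  S≡powerSum : ∀ m k → .{{NonZero m}} → + S m k ≡ powerSum m (suc k)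
  S≡powerSum m zero    = sym (trans (+-identityˡ (0ℤ ^ m)) (0^n≡0 m))
  S≡powerSum m (suc k) = trans (pos-+ (S m k) (suc k ℕ.^ m)) (cong₂ _+_ (S≡powerSum m k) (pos-^ (suc k) m))

  ∣⇒∣^ : ∀ {d a} n .{{_ : NonZero n}} → d ∣ a → d ∣ a ^ n
  ∣⇒∣^ (suc n) d∣a = ∣m⇒∣m*n _ d∣a

  S≈powerSum : ∀ {p} N f M → .{{_ : NonZero N}} → N ≡ p ℕ.^ suc f ℕ.* M →
               + S N N ≈ + M * (+ (p ℕ.^ f) * powerSum N p) mod + (p ℕ.^ suc f)
  S≈powerSum {p} N f M N≡p^e*M = begin
    + S N N                             ≡⟨ S≡powerSum N N ⟩
    powerSum N N + (+ N) ^ N            ≈⟨ mod-+ (mod-refl (powerSum N N)) (∣⇒≈0 (∣⇒∣^ N (∣ᵤ⇒∣ p^e∣N))) ⟩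
    powerSum N N + 0ℤ                   ≡⟨ trans (+-identityʳ _) (cong (powerSum N) N≡M*p^e) ⟩
    powerSum N (M ℕ.* p ℕ.^ suc f)      ≈⟨ powerSum-periodic N M (p ℕ.^ suc f) ⟩
    + M * powerSum N (p ℕ.^ suc f)      ≈⟨ mod-*ˡ (+ M) (powerSum-prime-power N f p∣N) ⟩
    + M * (+ (p ℕ.^ f) * powerSum N p)  ∎
    where
    open mod-Reasoning (+ (p ℕ.^ suc f))
    N≡M*p^e : N ≡ M ℕ.* p ℕ.^ suc f
    N≡M*p^e = trans N≡p^e*M (ℕ.*-comm (p ℕ.^ suc f) M)
    p^e∣N : p ℕ.^ suc f ℕ.∣ N
    p^e∣N = ℕ.divides M N≡M*p^e
    p∣N : p ℕ.∣ N
    p∣N = ℕ.∣-trans (ℕ.m∣m*n (p ℕ.^ f)) p^e∣N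

  S≈-p^f*M : ∀ {p} N f M → .{{_ : NonZero N}} → Prime p → N ≡ p ℕ.^ suc f ℕ.* M → (p ℕ.∸ 1) ℕ.∣ N →
             + S N N ≈ - + (p ℕ.^ f ℕ.* M) mod + (p ℕ.^ suc f)
  S≈-p^f*M {p} N f M pr N≡p^e*M p-1∣N = begin
    + S N N                             ≈⟨ S≈powerSum N f M N≡p^e*M ⟩
    + M * (+ (p ℕ.^ f) * powerSum N p)  ≈⟨ mod-*ˡ (+ M) (mod-∣ (∣-reflexive p^e≡p^f*p)
                                             (mod-scale (+ (p ℕ.^ f)) (powerSum≈-1 pr p-1∣N))) ⟩
    + M * (+ (p ℕ.^ f) * - 1ℤ)          ≡⟨ eq (+ M) (+ (p ℕ.^ f)) ⟩
    - (+ (p ℕ.^ f) * + M)               ≡⟨ cong -_ (sym (pos-* (p ℕ.^ f) M)) ⟩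
    - + (p ℕ.^ f ℕ.* M)                 ∎
    where
    open mod-Reasoning (+ (p ℕ.^ suc f))
    p^e≡p^f*p : + (p ℕ.^ suc f) ≡ + (p ℕ.^ f) * + p
    p^e≡p^f*p = trans (pos-* p (p ℕ.^ f)) (*-comm (+ p) _)
    eq : ∀ m x → m * (x * - 1ℤ) ≡ - (x * m)
    eq = solve-∀

  S≈0 : ∀ {p} N f M → .{{_ : NonZero N}} → Prime p → N ≡ p ℕ.^ suc f ℕ.* M → ¬ (p ℕ.∸ 1) ℕ.∣ N →
        + S N N ≈ 0ℤ mod + (p ℕ.^ suc f)
  S≈0 {p} N f M pr N≡p^e*M p-1∤N =
    mod-trans (S≈powerSum N f M N≡p^e*M) (∣⇒≈0 (∣n⇒∣m*n (+ M) p^e∣p^f*P))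
    where
    p∣P : + p ∣ powerSum N p
    p∣P = p∣powerSum[p-1∤m] pr p-1∤N
    p^e∣p^f*P : + (p ℕ.^ suc f) ∣ + (p ℕ.^ f) * powerSum N p
    p^e∣p^f*P = ∣-resp-≡ (*-comm (powerSum N p) _)
                  (∣-trans (∣-reflexive (pos-* p (p ℕ.^ f))) (*-monoˡ-∣ (+ (p ℕ.^ f)) p∣P))

  -- Prime-power parts

  prime>1 : ∀ {p} → Prime p → 1 ℕ.< p
  prime>1 {p} pr = ℕ.nonTrivial⇒n>1 p {{prime⇒nonTrivial pr}}

  ^-monoʳ-∣ : ∀ p {a b} → a ℕ.≤ b → p ℕ.^ a ℕ.∣ p ℕ.^ b
  ^-monoʳ-∣ p {a} a≤b with ℕ.m≤n⇒∃[o]m+o≡n a≤b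
  ... | o , refl = ℕ.divides (p ℕ.^ o) (trans (ℕ.^-distribˡ-+-* p a o) (ℕ.*-comm (p ℕ.^ a) (p ℕ.^ o)))

  euclidsLemma^ : ∀ {p u} e v → Prime p → ¬ p ℕ.∣ u → p ℕ.^ e ℕ.∣ u ℕ.* v → p ℕ.^ e ℕ.∣ v
  euclidsLemma^ zero v pr p∤u _ = ℕ.1∣ v
  euclidsLemma^ {p} {u} (suc e) v pr p∤u p^e∣uv
    with euclidsLemma′ v pr p∤u (ℕ.∣-trans (ℕ.m∣m*n (p ℕ.^ e)) p^e∣uv)
  ... | ℕ.divides w refl =
    subst (ℕ._∣ w ℕ.* p) (ℕ.*-comm (p ℕ.^ e) p) (ℕ.*-monoˡ-∣ p (euclidsLemma^ e w pr p∤u p^e∣uw))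
    where
    instance _ = prime⇒nonZero pr
    eq : ∀ u w p → u ℕ.* (w ℕ.* p) ≡ p ℕ.* (u ℕ.* w)
    eq = ℕ-Solver.solve-∀
    p^e∣uw : p ℕ.^ e ℕ.∣ u ℕ.* w
    p^e∣uw = ℕ.*-cancelˡ-∣ p (subst (p ℕ.* p ℕ.^ e ℕ.∣_) (eq u w p) p^e∣uv)

  factor-out : ∀ {p} → Prime p → ∀ x → .{{NonZero x}} → ∃₂ λ e M → x ≡ p ℕ.^ e ℕ.* M × ¬ p ℕ.∣ M
  factor-out {p} pr x {{x≢0}} = <-rec Factorisation step x x≢0
    where
    Factorisation : ℕ → Set
    Factorisation x = .(NonZero x) → ∃₂ λ e M → x ≡ p ℕ.^ e ℕ.* M × ¬ p ℕ.∣ M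
    step : ∀ x → (∀ {y} → y ℕ.< x → Factorisation y) → Factorisation x
    step x rec x≢0 with p ℕ.∣? x
    ... | no  p∤x = 0 , x , sym (ℕ.+-identityʳ x) , p∤x
    ... | yes (ℕ.divides y x≡y*p) = extend (rec y<x y≢0)
      where
      instance
        y≢0 : NonZero y
        y≢0 = ℕ.m*n≢0⇒m≢0 y {{subst NonZero x≡y*p x≢0}}
      y<x : y ℕ.< x
      y<x = subst (y ℕ.<_) (sym x≡y*p) (ℕ.m<m*n y p (prime>1 pr))
      eq : ∀ a M p → a ℕ.* M ℕ.* p ≡ p ℕ.* a ℕ.* M
      eq = ℕ-Solver.solve-∀
      extend : (∃₂ λ e M → y ≡ p ℕ.^ e ℕ.* M × ¬ p ℕ.∣ M) → ∃₂ λ e M → x ≡ p ℕ.^ e ℕ.* M × ¬ p ℕ.∣ M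
      extend (e , M , y≡p^e*M , p∤M) =
        suc e , M , trans x≡y*p (trans (cong (ℕ._* p) y≡p^e*M) (eq (p ℕ.^ e) M p)) , p∤M

  factor-out-prime-divisor : ∀ {p x} → Prime p → p ℕ.∣ x → .{{NonZero x}} →
                             ∃₂ λ f M → x ≡ p ℕ.^ suc f ℕ.* M × ¬ p ℕ.∣ M
  factor-out-prime-divisor {p} {x} pr p∣x with factor-out pr x
  ... | zero  , M , x≡1*M , p∤M = ⊥-elim (p∤M (subst (p ℕ.∣_) (trans x≡1*M (ℕ.*-identityˡ M)) p∣x))
  ... | suc f , M , x≡p^e*M , p∤M = f , M , x≡p^e*M , p∤M

  p^[1+e]∤p^e*M : ∀ {p M} e → Prime p → ¬ p ℕ.∣ M → ¬ p ℕ.^ suc e ℕ.∣ p ℕ.^ e ℕ.* M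
  p^[1+e]∤p^e*M {p} {M} e pr p∤M p^[1+e]∣p^e*M =
    p∤M (ℕ.*-cancelˡ-∣ (p ℕ.^ e) (subst (ℕ._∣ p ℕ.^ e ℕ.* M) (ℕ.*-comm p (p ℕ.^ e)) p^[1+e]∣p^e*M))
    where instance _ = ℕ.m^n≢0 p e {{prime⇒nonZero pr}}

  p^f∣p^e*M⇒p^f∣p^e : ∀ {p M} f e → Prime p → ¬ p ℕ.∣ M → p ℕ.^ f ℕ.∣ p ℕ.^ e ℕ.* M → p ℕ.^ f ℕ.∣ p ℕ.^ e
  p^f∣p^e*M⇒p^f∣p^e {p} f e pr p∤M p^f∣p^e*M with f ℕ.≤? e
  ... | yes f≤e = ^-monoʳ-∣ p f≤e
  ... | no  f≰e = ⊥-elim (p^[1+e]∤p^e*M e pr p∤M (ℕ.∣-trans (^-monoʳ-∣ p (ℕ.≰⇒> f≰e)) p^f∣p^e*M))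

  ∃-prime-divisor : ∀ N → .{{NonZero N}} → N ≢ 1 → ∃ λ p → Prime p × p ℕ.∣ N
  ∃-prime-divisor N N≢1 with factorise N
  ... | record { factors = []     ; isFactorisation = N≡1 } = ⊥-elim (N≢1 N≡1)
  ... | record { factors = p ∷ ps ; isFactorisation = N≡p*ps ; factorsPrime = pr ∷ _ } =
    p , pr , ℕ.divides (product ps) (trans N≡p*ps (ℕ.*-comm p (product ps)))

  coprime-parts-∣ : ∀ {p M D} e → Prime p → ¬ p ℕ.∣ M → + (p ℕ.^ e) ∣ D → + M ∣ D → + (p ℕ.^ e ℕ.* M) ∣ D
  coprime-parts-∣ {p} {M} e pr p∤M p^e∣D (divides w D≡w*M) =
    ∣-resp-≡ (sym D≡w*M) (∣-trans (∣-reflexive (pos-* (p ℕ.^ e) M)) (*-monoˡ-∣ (+ M) p^e∣w))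
    where
    p^e∣M*∣w∣ : p ℕ.^ e ℕ.∣ M ℕ.* ℤ.∣ w ∣
    p^e∣M*∣w∣ = subst (p ℕ.^ e ℕ.∣_) (trans (abs-* w (+ M)) (ℕ.*-comm ℤ.∣ w ∣ M))
                      (∣⇒∣ᵤ (∣-resp-≡ D≡w*M p^e∣D))
    p^e∣w : + (p ℕ.^ e) ∣ w
    p^e∣w = ∣ᵤ⇒∣ (euclidsLemma^ e ℤ.∣ w ∣ pr p∤M p^e∣M*∣w∣)

  prime-powers-∣⇒∣ : ∀ N .{{_ : NonZero N}} D → (∀ p f → Prime p → p ℕ.^ f ℕ.∣ N → + (p ℕ.^ f) ∣ D) → + N ∣ D
  prime-powers-∣⇒∣ N {{N≢0}} D = <-rec Goal step N N≢0
    where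
    Goal : ℕ → Set
    Goal N = .(NonZero N) → (∀ p f → Prime p → p ℕ.^ f ℕ.∣ N → + (p ℕ.^ f) ∣ D) → + N ∣ D
    step : ∀ N → (∀ {M} → M ℕ.< N → Goal M) → Goal N
    step N rec N≢0 hyp with N ℕ.≟ 1
    ... | yes refl = divides D (sym (*-identityʳ D))
    ... | no  N≢1 with ∃-prime-divisor N {{N≢0}} N≢1
    ...   | p , pr , p∣N with factor-out-prime-divisor pr p∣N {{N≢0}}
    ...     | f , M , N≡p^e*M , p∤M =
      subst (λ x → + x ∣ D) (sym N≡p^e*M) (coprime-parts-∣ (suc f) pr p∤M (hyp p (suc f) pr p^e∣N) M∣D)
      where
      M∣N : M ℕ.∣ N
      M∣N = ℕ.divides (p ℕ.^ suc f) N≡p^e*M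
      p^e∣N : p ℕ.^ suc f ℕ.∣ N
      p^e∣N = ℕ.divides M (trans N≡p^e*M (ℕ.*-comm (p ℕ.^ suc f) M))
      M≢0 : NonZero M
      M≢0 = ℕ.m*n≢0⇒n≢0 (p ℕ.^ suc f) {{subst NonZero N≡p^e*M N≢0}}
      1<p^e : 1 ℕ.< p ℕ.^ suc f
      1<p^e = ℕ.<-≤-trans (prime>1 pr) (ℕ.m≤m*n p (p ℕ.^ f) {{ℕ.m^n≢0 p f {{prime⇒nonZero pr}}}})
      M<N : M ℕ.< N
      M<N = subst (M ℕ.<_) (trans (ℕ.*-comm M (p ℕ.^ suc f)) (sym N≡p^e*M))
                  (ℕ.m<m*n M (p ℕ.^ suc f) {{M≢0}} 1<p^e)
      M∣D : + M ∣ D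
      M∣D = rec M<N M≢0 λ q g prq q^g∣M → hyp q g prq (ℕ.∣-trans q^g∣M M∣N)

  -- The local criterion

  LocalCondition : (Q n p : ℕ) → Prime p → Set
  LocalCondition Q n p pr =
    (p ℕ.∣ Q → (p ℕ.∸ 1) ℕ.∣ Q ℕ.* n × p ℕ.∣ _/_ Q p {{prime⇒nonZero pr}} ℕ.+ 1) ×
    (p ℕ.∣ n → p ℕ.∤ Q → (p ℕ.∸ 1) ℕ.∤ Q ℕ.* n)

  module _ {p Q n f M} (pr : Prime p) (Qn≡p^e*M : Q ℕ.* n ≡ p ℕ.^ suc f ℕ.* M) (p∤M : ¬ p ℕ.∣ M) where

    private
      instance _ = prime⇒nonZero pr

    p∣Q⇒p^e∤n : p ℕ.∣ Q → ¬ p ℕ.^ suc f ℕ.∣ n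
    p∣Q⇒p^e∤n p∣Q p^e∣n =
      p^[1+e]∤p^e*M (suc f) pr p∤M (subst (p ℕ.* p ℕ.^ suc f ℕ.∣_) Qn≡p^e*M (ℕ.*-pres-∣ p∣Q p^e∣n))

    p∤Q⇒p^e∣n : ¬ p ℕ.∣ Q → p ℕ.^ suc f ℕ.∣ n
    p∤Q⇒p^e∣n p∤Q = euclidsLemma^ (suc f) n pr p∤Q (ℕ.divides M (trans Qn≡p^e*M (ℕ.*-comm (p ℕ.^ suc f) M)))

    p∤Q⇒p^e∤p^f*M+n : ¬ p ℕ.∣ Q → ¬ p ℕ.^ suc f ℕ.∣ p ℕ.^ f ℕ.* M ℕ.+ n
    p∤Q⇒p^e∤p^f*M+n p∤Q p^e∣p^f*M+n = p^[1+e]∤p^e*M f pr p∤M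
      (ℕ.∣m+n∣m⇒∣n (subst (p ℕ.^ suc f ℕ.∣_) (ℕ.+-comm _ n) p^e∣p^f*M+n) (p∤Q⇒p^e∣n p∤Q))

    p∣Q⇒[p^e∣p^f*M+n⇔p∣Q/p+1] : p ℕ.∣ Q → (p ℕ.^ suc f ℕ.∣ p ℕ.^ f ℕ.* M ℕ.+ n ⇔ p ℕ.∣ Q / p ℕ.+ 1)
    p∣Q⇒[p^e∣p^f*M+n⇔p∣Q/p+1] p∣Q@(ℕ.divides x Q≡x*p) =
      subst (λ y → p ℕ.^ suc f ℕ.∣ y ⇔ p ℕ.∣ Q / p ℕ.+ 1) (sym p^f*M+n≡n*[x+1])
        (subst (λ y → p ℕ.^ suc f ℕ.∣ n ℕ.* (x ℕ.+ 1) ⇔ p ℕ.∣ y ℕ.+ 1) (sym Q/p≡x) (mk⇔ to from))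
      where
      Q/p≡x : Q / p ≡ x
      Q/p≡x = trans (/-congˡ Q≡x*p) (m*n/n≡m x p)
      p^f*M+n≡n*[x+1] : p ℕ.^ f ℕ.* M ℕ.+ n ≡ n ℕ.* (x ℕ.+ 1)
      p^f*M+n≡n*[x+1] = ℕ.*-cancelˡ-≡ _ _ p (begin
        p ℕ.* (p ℕ.^ f ℕ.* M ℕ.+ n)    ≡⟨ eq₁ p (p ℕ.^ f) M n ⟩
        p ℕ.^ suc f ℕ.* M ℕ.+ p ℕ.* n  ≡⟨ cong (ℕ._+ p ℕ.* n) (sym Qn≡p^e*M) ⟩
        Q ℕ.* n ℕ.+ p ℕ.* n            ≡⟨ cong (λ q → q ℕ.* n ℕ.+ p ℕ.* n) Q≡x*p ⟩
        x ℕ.* p ℕ.* n ℕ.+ p ℕ.* n      ≡⟨ eq₂ x p n ⟩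
        p ℕ.* (n ℕ.* (x ℕ.+ 1))        ∎)
        where
        open ≡-Reasoning
        eq₁ : ∀ p a M n → p ℕ.* (a ℕ.* M ℕ.+ n) ≡ p ℕ.* a ℕ.* M ℕ.+ p ℕ.* n
        eq₁ = ℕ-Solver.solve-∀
        eq₂ : ∀ x p n → x ℕ.* p ℕ.* n ℕ.+ p ℕ.* n ≡ p ℕ.* (n ℕ.* (x ℕ.+ 1))
        eq₂ = ℕ-Solver.solve-∀
      to : p ℕ.^ suc f ℕ.∣ n ℕ.* (x ℕ.+ 1) → p ℕ.∣ x ℕ.+ 1
      to p^e∣n*[x+1] with p ℕ.∣? x ℕ.+ 1
      ... | yes p∣x+1 = p∣x+1
      ... | no  p∤x+1 = ⊥-elim (p∣Q⇒p^e∤n p∣Q (euclidsLemma^ (suc f) n pr p∤x+1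
                          (subst (p ℕ.^ suc f ℕ.∣_) (ℕ.*-comm n (x ℕ.+ 1)) p^e∣n*[x+1])))
      from : p ℕ.∣ x ℕ.+ 1 → p ℕ.^ suc f ℕ.∣ n ℕ.* (x ℕ.+ 1)
      from p∣x+1 = subst (ℕ._∣ n ℕ.* (x ℕ.+ 1)) (ℕ.*-comm (p ℕ.^ f) p) (ℕ.*-pres-∣ p^f∣n p∣x+1)
        where
        p∤x : ¬ p ℕ.∣ x
        p∤x p∣x = ℕ.<⇒≢ (prime>1 pr) (sym (ℕ.∣1⇒≡1 (ℕ.∣m+n∣m⇒∣n p∣x+1 p∣x)))
        xn≡p^f*M : x ℕ.* n ≡ p ℕ.^ f ℕ.* M
        xn≡p^f*M = ℕ.*-cancelˡ-≡ _ _ p (begin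
          p ℕ.* (x ℕ.* n)        ≡⟨ eq x p n ⟩
          x ℕ.* p ℕ.* n          ≡⟨ cong (ℕ._* n) (sym Q≡x*p) ⟩
          Q ℕ.* n                ≡⟨ Qn≡p^e*M ⟩
          p ℕ.^ suc f ℕ.* M      ≡⟨ ℕ.*-assoc p (p ℕ.^ f) M ⟩
          p ℕ.* (p ℕ.^ f ℕ.* M)  ∎)
          where
          open ≡-Reasoning
          eq : ∀ x p n → p ℕ.* (x ℕ.* n) ≡ x ℕ.* p ℕ.* n
          eq = ℕ-Solver.solve-∀
        p^f∣n : p ℕ.^ f ℕ.∣ n
        p^f∣n = euclidsLemma^ f n pr p∤x (ℕ.divides M (trans xn≡p^f*M (ℕ.*-comm (p ℕ.^ f) M)))

    module _ .{{_ : NonZero Q}} .{{_ : NonZero n}} where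

      private
        N = Q ℕ.* n
        instance _ = ℕ.m*n≢0 Q n

      ∣S-n⇔∣X+n : ∀ X → + S N N ≈ - + X mod + (p ℕ.^ suc f) →
                  + (p ℕ.^ suc f) ∣ + S N N - + n ⇔ p ℕ.^ suc f ℕ.∣ X ℕ.+ n
      ∣S-n⇔∣X+n X S≈-X = +∣-+⇔∣ ⇔-∘ mod-∣⇔∣ (begin
        + S N N - + n  ≈⟨ mod-+ S≈-X (mod-refl (- + n)) ⟩
        - + X - + n    ≡⟨ sym (neg-distrib-+ (+ X) (+ n)) ⟩
        - (+ X + + n)  ≡⟨ cong -_ (sym (pos-+ X n)) ⟩
        - + (X ℕ.+ n)  ∎)
        where open mod-Reasoning (+ (p ℕ.^ suc f))

      local-criterion : + (p ℕ.^ suc f) ∣ + S N N - + n ⇔ LocalCondition Q n p pr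
      local-criterion with (p ℕ.∸ 1) ℕ.∣? N | p ℕ.∣? Q
      ... | yes p-1∣N | yes p∣Q =
        mk⇔ (λ h → (λ _ → p-1∣N , h) , λ _ p∤Q → ⊥-elim (p∤Q p∣Q)) (λ lc → proj₂ (proj₁ lc p∣Q))
        ⇔-∘ (p∣Q⇒[p^e∣p^f*M+n⇔p∣Q/p+1] p∣Q
        ⇔-∘ ∣S-n⇔∣X+n (p ℕ.^ f ℕ.* M) (S≈-p^f*M N f M pr Qn≡p^e*M p-1∣N))
      ... | yes p-1∣N | no  p∤Q =
        mk⇔ (λ h → ⊥-elim (p∤Q⇒p^e∤p^f*M+n p∤Q (Equivalence.to divisibility h)))
            (λ lc → ⊥-elim (proj₂ lc p∣n p∤Q p-1∣N))
        where
        divisibility = ∣S-n⇔∣X+n (p ℕ.^ f ℕ.* M) (S≈-p^f*M N f M pr Qn≡p^e*M p-1∣N)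
        p∣n : p ℕ.∣ n
        p∣n = euclidsLemma′ n pr p∤Q
          (subst (p ℕ.∣_) (sym Qn≡p^e*M) (ℕ.∣-trans (ℕ.m∣m*n (p ℕ.^ f)) (ℕ.m∣m*n M)))
      ... | no  p-1∤N | yes p∣Q =
        mk⇔ (λ h → ⊥-elim (p∣Q⇒p^e∤n p∣Q (Equivalence.to divisibility h)))
            (λ lc → ⊥-elim (p-1∤N (proj₁ (proj₁ lc p∣Q))))
        where divisibility = ∣S-n⇔∣X+n 0 (S≈0 N f M pr Qn≡p^e*M p-1∤N)
      ... | no  p-1∤N | no  p∤Q =
        mk⇔ (λ _ → (λ p∣Q → ⊥-elim (p∤Q p∣Q)) , λ _ _ → p-1∤N)
            (λ _ → Equivalence.from divisibility (p∤Q⇒p^e∣n p∤Q))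
        where divisibility = ∣S-n⇔∣X+n 0 (S≈0 N f M pr Qn≡p^e*M p-1∤N)

  ∣S-n⇔LocalConditions : ∀ Q n .{{_ : NonZero Q}} .{{_ : NonZero n}} →
    + (Q ℕ.* n) ∣ + S (Q ℕ.* n) (Q ℕ.* n) - + n ⇔ (∀ p (pr : Prime p) → LocalCondition Q n p pr)
  ∣S-n⇔LocalConditions Q n = mk⇔ to from
    where
    N = Q ℕ.* n
    D = + S N N - + n
    instance _ = ℕ.m*n≢0 Q n
    to : + N ∣ D → ∀ p (pr : Prime p) → LocalCondition Q n p pr
    to N∣D p pr with p ℕ.∣? N
    ... | no  p∤N = (λ p∣Q → ⊥-elim (p∤N (ℕ.∣m⇒∣m*n n p∣Q))) , (λ p∣n _ → ⊥-elim (p∤N (ℕ.∣n⇒∣m*n Q p∣n)))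
    ... | yes p∣N with factor-out-prime-divisor pr p∣N
    ...   | f , M , N≡p^e*M , p∤M =
      Equivalence.to (local-criterion {Q = Q} {n} {f} pr N≡p^e*M p∤M)
        (∣-trans (∣ᵤ⇒∣ (ℕ.divides M (trans N≡p^e*M (ℕ.*-comm (p ℕ.^ suc f) M)))) N∣D)
    from : (∀ p (pr : Prime p) → LocalCondition Q n p pr) → + N ∣ D
    from lc = prime-powers-∣⇒∣ N D prime-power-part
      where
      prime-power-part : ∀ p e → Prime p → p ℕ.^ e ℕ.∣ N → + (p ℕ.^ e) ∣ D
      prime-power-part p zero    pr _ = divides D (sym (*-identityʳ D))
      prime-power-part p (suc e) pr p^e∣N
        with factor-out-prime-divisor pr (ℕ.∣-trans (ℕ.m∣m*n (p ℕ.^ e)) p^e∣N)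
      ... | f , M , N≡p^[1+f]*M , p∤M =
        ∣-trans (∣ᵤ⇒∣ (p^f∣p^e*M⇒p^f∣p^e (suc e) (suc f) pr p∤M (subst (p ℕ.^ suc e ℕ.∣_) N≡p^[1+f]*M p^e∣N)))
                (Equivalence.from (local-criterion {Q = Q} {n} {f} pr N≡p^[1+f]*M p∤M) (lc p pr))

  LocalConditions⇔conditions : ∀ Q n →
    (∀ p (pr : Prime p) → LocalCondition Q n p pr) ⇔
    (((p : ℕ) → (pr : Prime p) → p ℕ.∣ Q →
        ((p ℕ.∸ 1) ℕ.∣ (Q ℕ.* n)) × (p ℕ.∣ (_/_ Q p {{prime⇒nonZero pr}} ℕ.+ 1)))
     × ((p : ℕ) → Prime p → p ℕ.∣ n → p ℕ.∤ Q → (p ℕ.∸ 1) ℕ.∤ (Q ℕ.* n)))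
  LocalConditions⇔conditions Q n =
    mk⇔ (λ lc → (λ p pr → proj₁ (lc p pr)) , (λ p pr → proj₂ (lc p pr)))
        (λ (i , ii) p pr → i p pr , ii p pr)

open PowerSumCongruence using (%≡%⇔∣-; ∣S-n⇔LocalConditions; LocalConditions⇔conditions)

open import Data.Nat using (ℕ; _+_; _*_; _∸_; NonZero)
open import Data.Nat.DivMod using (_%_; _/_)
open import Data.Nat.Divisibility using (_∣_; _∤_)
open import Data.Nat.Primality using (Prime; prime⇒nonZero)
open import Data.Nat.Properties using (m*n≢0)
open import Data.Product using (_×_)
open import Function.Bundles using (_⇔_)
open import Relation.Binary.PropositionalEquality using (_≡_)
open import Function.Construct.Composition using (_⇔-∘_)

theorem2 : (Q n : ℕ) → .{{nzQ : NonZero Q}} → .{{nzn : NonZero n}} →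
  ((_%_ (S (Q * n) (Q * n)) (Q * n) {{m*n≢0 Q n}}) ≡ (_%_ n (Q * n) {{m*n≢0 Q n}}))
  ⇔ (((p : ℕ) → (pr : Prime p) → p ∣ Q →
        ((p ∸ 1) ∣ (Q * n)) × (p ∣ (_/_ Q p {{prime⇒nonZero pr}} + 1)))
     × ((p : ℕ) → Prime p → p ∣ n → p ∤ Q → (p ∸ 1) ∤ (Q * n)))
theorem2 Q n =
  LocalConditions⇔conditions Q n
  ⇔-∘ (∣S-n⇔LocalConditions Q n
  ⇔-∘ %≡%⇔∣- (S (Q * n) (Q * n)) n (Q * n) {{m*n≢0 Q n}})
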